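{- Let $N$ be an arboreal network such that $N$ has no vertex of outdegree 1 whose unique child is a non-leaf vertex. Then $C(u)\neq C(v)$ for all distinct internal vertices $u,v$ of $N$.
   Context: In a digraph, a leaf is a vertex of indegree 1 and outdegree 0, a root is a vertex of indegree 0, and an internal vertex is a vertex of outdegree at least 1. A network on a finite set $X$ ($|X|\ge2$) is a simple acyclic digraph $N$ whose underlying undirected graph is connected, whose set of leaves is $X$, in which every vertex of indegree 0 has outdegree at least 2, every vertex of outdegree 0 has indegree 1, and no vertex has both indegree and outdegree equal to 1. $N$ is arboreal if its underlying undirected graph is a tree. $C(v)$ is the set of leaves $x$ such that there is a directed path (possibly of length 0) from $v$ to $x$. -}

module Defs where

open import Data.Nat using (ℕ; zero; suc; _+_; _≥_; _≡ᵇ_)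
open import Data.Bool using (Bool; true; false; if_then_else_; T)
open import Data.Fin using (Fin; zero; suc; inject₁; fromℕ)
open import Data.List using (List; map; allFin)
open import Data.Nat.ListAction using (sum)
open import Data.Product using (_×_; Σ; ∃; ∃-syntax; _,_)
open import Data.Sum using (_⊎_)
open import Data.Empty using (⊥)
open import Relation.Nullary using (¬_)
open import Relation.Binary.PropositionalEquality using (_≡_; _≢_)
open import Relation.Binary.Construct.Closure.ReflexiveTransitive using (Star)
open import Relation.Binary.Construct.Closure.Transitive using (TransClosure)
open import Function.Definitions using (Injective)

-- A finite simple digraph on vertex set Fin n, given by a Boolean adjacency
-- matrix:  A u v = true  iff there is an arc u → v.  Multiple arcs are
-- impossible by construction; loops are excluded by 'Loopless'.
Digraph : ℕ → Set
Digraph n = Fin n → Fin n → Bool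

module _ {n : ℕ} (A : Digraph n) where

  Arc : Fin n → Fin n → Set
  Arc u v = T (A u v)

  indicator : Bool → ℕ
  indicator true  = 1
  indicator false = 0

  outdeg : Fin n → ℕ
  outdeg v = sum (map (λ u → indicator (A v u)) (allFin n))

  indeg : Fin n → ℕ
  indeg v = sum (map (λ u → indicator (A u v)) (allFin n))

  Loopless : Set
  Loopless = ∀ v → ¬ Arc v v

  Acyclic : Set
  Acyclic = ∀ v → ¬ TransClosure Arc v v

  Adj : Fin n → Fin n → Set
  Adj u v = Arc u v ⊎ Arc v u

  Connected : Set
  Connected = ∀ u v → Star Adj u v

  UCycle : Set
  UCycle = Σ ℕ λ k → Σ (Fin (suc (suc (suc k))) → Fin n) λ f →
             Injective _≡_ _≡_ f
           × (∀ (i : Fin (suc (suc k))) → Adj (f (inject₁ i)) (f (suc i)))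
           × Adj (f (fromℕ (suc (suc k)))) (f zero)

  Arboreal : Set
  Arboreal = Connected × ¬ UCycle

  Leaf : Fin n → Set
  Leaf v = indeg v ≡ 1 × outdeg v ≡ 0

  Internal : Fin n → Set
  Internal v = outdeg v ≥ 1

  Reach : Fin n → Fin n → Set
  Reach = Star Arc

  InC : Fin n → Fin n → Set
  InC v x = Leaf x × Reach v x

  SameC : Fin n → Fin n → Set
  SameC u v = ∀ x → (InC u x → InC v x) × (InC v x → InC u x)

  IsNetwork : Set
  IsNetwork =
      Loopless
    × Acyclic
    × Connected
    × (Σ (Fin n) λ x → Σ (Fin n) λ y → x ≢ y × Leaf x × Leaf y)
    × (∀ v → indeg v ≡ 0 → outdeg v ≥ 2)
    × (∀ v → outdeg v ≡ 0 → indeg v ≡ 1)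
    × (∀ v → ¬ (indeg v ≡ 1 × outdeg v ≡ 1))

{-# OPTIONS --safe #-}

-- Everything rests on one fact about trees: two distinct children c, c′ of a
-- vertex a cannot be joined by an undirected walk avoiding a, since that walk,
-- shortened to a path and closed up through a, would be a cycle. Now let u ≠ v
-- be internal with C(u) = C(v). If v were a proper ancestor of u, say via the
-- arc v → d, then d is not a leaf (it reaches the internal u), so by hypothesis
-- v has a second child d′; a leaf below d′ lies in C(v) = C(u), hence below u,
-- which joins d′ to d avoiding v. Otherwise v reaches every leaf below u without
-- passing through u. If u has a single child, that child is a leaf whose only
-- parent is u, so v would be that leaf; if u has two children, leaves below
-- each of them are joined through v, avoiding u.
module Submission where

open import Defs
import Data.Nat.Properties as ℕ
open import Algebra.Properties.CommutativeMonoid.Sum ℕ.+-0-commutativeMonoid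
  using (sum; sum-remove)
open import Data.Bool using (true; false; T)
open import Data.Empty using (⊥; ⊥-elim)
open import Data.Fin using (Fin; zero; suc; inject₁; fromℕ; punchIn; punchOut)
open import Data.Fin.Properties using (_≟_; pigeonhole; punchInᵢ≢i; punchIn-punchOut; <⇒≢)
open import Data.List using (List; []; _∷_; length; lookup; tabulate; map; allFin)
open import Data.List.Properties using (map-tabulate)
open import Data.List.Membership.Propositional using (_∈_)
open import Data.List.Membership.Propositional.Properties using (∈-lookup)
import Data.List.Membership.DecPropositional as DecMembership
open import Data.List.Relation.Unary.All using (All; []; _∷_)
import Data.List.Relation.Unary.All as All
open import Data.List.Relation.Unary.All.Properties using (¬Any⇒All¬)
open import Data.List.Relation.Unary.Any using (here; there)
open import Data.List.Relation.Unary.Unique.Propositional using (Unique)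
open import Data.List.Relation.Unary.AllPairs using ([]; _∷_)
import Data.Nat.ListAction as ListAction
open import Data.Nat using (ℕ; zero; suc; _+_; _≤_)
open import Data.Nat.Properties
  using ( m≤m+n; m≤n+m; ≤-trans; +-monoʳ-≤; +-identityʳ; n>0⇒n≢0; n≢0⇒n>0; 1+n≰n; <-irrefl
        ; ≰⇒>; _≤?_)
open import Data.Product using (_×_; ∃-syntax; Σ-syntax; _,_; proj₁; proj₂)
open import Data.Sum using (_⊎_; inj₁; inj₂; swap)
open import Function using (_∘_; id)
open import Relation.Binary using (Rel; DecidableEquality)
open import Relation.Binary.Construct.Closure.ReflexiveTransitive using (Star; ε; _◅_; _◅◅_; reverse)
import Relation.Binary.Construct.Closure.ReflexiveTransitive as Star
open import Relation.Binary.Construct.Closure.Transitive using (TransClosure; [_]; _∷_)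
open import Relation.Binary.PropositionalEquality
  using (_≡_; _≢_; refl; sym; trans; cong; cong₂; subst; ≢-sym)
open import Relation.Nullary using (¬_; yes; no; contradiction)

≤-sum : ∀ {m} (f : Fin m → ℕ) i → f i ≤ sum f
≤-sum f zero    = m≤m+n _ _
≤-sum f (suc i) = ≤-trans (≤-sum (f ∘ suc) i) (m≤n+m _ _)

sum≢0⇒nonzero : ∀ {m} (f : Fin m → ℕ) → sum f ≢ 0 → ∃[ i ] f i ≢ 0
sum≢0⇒nonzero {zero}  f sum≢0 = contradiction refl sum≢0
sum≢0⇒nonzero {suc m} f sum≢0 with f zero ℕ.≟ 0
... | no f₀≢0 = zero , f₀≢0
... | yes f₀≡0 =
  let i , fᵢ≢0 = sum≢0⇒nonzero (f ∘ suc) (sum≢0 ∘ cong₂ _+_ f₀≡0) in suc i , fᵢ≢0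

sum≢⇒otherNonzero : ∀ {m} (f : Fin m → ℕ) i → sum f ≢ f i → ∃[ j ] j ≢ i × f j ≢ 0
sum≢⇒otherNonzero {suc m} f i sum≢fᵢ =
  let k , fₖ≢0 = sum≢0⇒nonzero (f ∘ punchIn i) rest≢0 in punchIn i k , punchInᵢ≢i i k , fₖ≢0
  where
  rest≢0 : sum (f ∘ punchIn i) ≢ 0
  rest≢0 rest≡0 = sum≢fᵢ (trans (sum-remove {i = i} f) (trans (cong (f i +_) rest≡0) (+-identityʳ _)))

+-≤-sum : ∀ {m} (f : Fin m → ℕ) {i j} → i ≢ j → f i + f j ≤ sum f
+-≤-sum {suc m} f {i} {j} i≢j = subst (f i + f j ≤_) (sym (sum-remove {i = i} f))
  (+-monoʳ-≤ (f i) (subst (_≤ sum (f ∘ punchIn i)) (cong f (punchIn-punchOut i≢j))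
                                 (≤-sum (f ∘ punchIn i) (punchOut i≢j))))

sum-tabulate : ∀ {m} (f : Fin m → ℕ) → ListAction.sum (tabulate f) ≡ sum f
sum-tabulate {zero}  f = refl
sum-tabulate {suc m} f = cong (f zero +_) (sum-tabulate (f ∘ suc))

sum-map-allFin : ∀ {m} (f : Fin m → ℕ) → ListAction.sum (map f (allFin m)) ≡ sum f
sum-map-allFin f = trans (cong ListAction.sum (map-tabulate id f)) (sum-tabulate f)

module _ {n : ℕ} (A : Digraph n) where

  indicator≢0⇒T : ∀ b → indicator A b ≢ 0 → T b
  indicator≢0⇒T true  _  = _
  indicator≢0⇒T false ≢0 = ≢0 refl

  T⇒indicator≡1 : ∀ {b} → T b → indicator A b ≡ 1
  T⇒indicator≡1 {true} _ = refl

  outdeg≡sum : ∀ v → outdeg A v ≡ sum (λ w → indicator A (A v w))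
  outdeg≡sum v = sum-map-allFin (λ w → indicator A (A v w))

  indeg≡sum : ∀ v → indeg A v ≡ sum (λ u → indicator A (A u v))
  indeg≡sum v = sum-map-allFin (λ u → indicator A (A u v))

  outdeg≡0⇒¬Arc : ∀ {v w} → outdeg A v ≡ 0 → ¬ Arc A v w
  outdeg≡0⇒¬Arc {v} {w} deg≡0 vw = contradiction (begin
    1                                ≡⟨ T⇒indicator≡1 vw ⟨
    indicator A (A v w)              ≤⟨ ≤-sum _ w ⟩
    sum (λ u → indicator A (A v u))  ≡⟨ outdeg≡sum v ⟨
    outdeg A v                       ≡⟨ deg≡0 ⟩
    0                                ∎) λ ()
    where open ℕ.≤-Reasoning

  outdeg≡0⇒Reach-refl : ∀ {v x} → outdeg A v ≡ 0 → Reach A v x → v ≡ x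
  outdeg≡0⇒Reach-refl deg≡0 ε       = refl
  outdeg≡0⇒Reach-refl deg≡0 (r ◅ _) = contradiction r (outdeg≡0⇒¬Arc deg≡0)

  Leaf⇒¬Internal : ∀ {v} → Leaf A v → ¬ Internal A v
  Leaf⇒¬Internal (_ , deg≡0) internal = n>0⇒n≢0 internal deg≡0

  Internal⇒child : ∀ {v} → Internal A v → ∃[ c ] Arc A v c
  Internal⇒child {v} internal =
    let c , c≢0 = sum≢0⇒nonzero _ (subst (_≢ 0) (outdeg≡sum v) (n>0⇒n≢0 internal))
    in c , indicator≢0⇒T _ c≢0

  outdeg≢1⇒otherChild : ∀ {v c} → outdeg A v ≢ 1 → Arc A v c → ∃[ c′ ] c′ ≢ c × Arc A v c′
  outdeg≢1⇒otherChild {v} {c} deg≢1 vc =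
    let c′ , c′≢c , c′≢0 = sum≢⇒otherNonzero _ c
          (λ sum≡ → deg≢1 (trans (outdeg≡sum v) (trans sum≡ (T⇒indicator≡1 vc))))
    in c′ , c′≢c , indicator≢0⇒T _ c′≢0

  indeg≡1⇒uniqueParent : ∀ {x u w} → indeg A x ≡ 1 → Arc A u x → Arc A w x → u ≡ w
  indeg≡1⇒uniqueParent {x} {u} {w} deg≡1 ux wx with u ≟ w
  ... | yes u≡w = u≡w
  ... | no u≢w = contradiction (begin
    2                                          ≡⟨ cong₂ _+_ (T⇒indicator≡1 ux) (T⇒indicator≡1 wx) ⟨
    indicator A (A u x) + indicator A (A w x)  ≤⟨ +-≤-sum _ u≢w ⟩
    sum (λ p → indicator A (A p x))            ≡⟨ indeg≡sum x ⟨
    indeg A x                                  ≡⟨ deg≡1 ⟩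
    1                                          ∎) 1+n≰n
    where open ℕ.≤-Reasoning

lookup-injective : ∀ {a} {X : Set a} {xs : List X} → Unique xs →
                   ∀ {i j} → lookup xs i ≡ lookup xs j → i ≡ j
lookup-injective {xs = _ ∷ _} _            {zero}  {zero}  _     = refl
lookup-injective {xs = _ ∷ _} (x∉xs ∷ _)   {zero}  {suc j} x≡xⱼ  = contradiction x≡xⱼ (All.lookup x∉xs (∈-lookup j))
lookup-injective {xs = _ ∷ _} (x∉xs ∷ _)   {suc i} {zero}  xᵢ≡x  = contradiction (sym xᵢ≡x) (All.lookup x∉xs (∈-lookup i))
lookup-injective {xs = _ ∷ _} (_ ∷ unique) {suc i} {suc j} xᵢ≡xⱼ = cong suc (lookup-injective unique xᵢ≡xⱼ)

Unique⇒length≤ : ∀ {n} {xs : List (Fin n)} → Unique xs → length xs ≤ n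
Unique⇒length≤ {n} {xs} unique with length xs ≤? n
... | yes ≤n = ≤n
... | no ≰n =
  let i , j , i<j , xᵢ≡xⱼ = pigeonhole (≰⇒> ≰n) (lookup xs)
  in contradiction (lookup-injective unique xᵢ≡xⱼ) (<⇒≢ i<j)

module _ {a ℓ} {I : Set a} {R : Rel I ℓ} where

  targets : ∀ {p q} → Star R p q → List I
  targets ε                   = []
  targets (_◅_ {j = y} _ w) = y ∷ targets w

  lookup-targets-step : ∀ {p q} (w : Star R p q) (i : Fin (length (targets w))) →
                        R (lookup (p ∷ targets w) (inject₁ i)) (lookup (p ∷ targets w) (suc i))
  lookup-targets-step (r ◅ w) zero    = r
  lookup-targets-step (r ◅ w) (suc i) = lookup-targets-step w i

  lookup-targets-last : ∀ {p q} (w : Star R p q) → lookup (p ∷ targets w) (fromℕ (length (targets w))) ≡ q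
  lookup-targets-last ε       = refl
  lookup-targets-last (r ◅ w) = lookup-targets-last w

  ∈-vertices⇒Star : ∀ {p q x} (w : Star R p q) → x ∈ p ∷ targets w → Star R p x
  ∈-vertices⇒Star w       (here refl) = ε
  ∈-vertices⇒Star (r ◅ w) (there x∈)  = r ◅ ∈-vertices⇒Star w x∈

  module _ (_≟ᴵ_ : DecidableEquality I) where
    open DecMembership _≟ᴵ_ using (_∈?_)

    suffixFrom : ∀ {y q x} (w : Star R y q) → x ∈ y ∷ targets w → Unique (y ∷ targets w) →
                 Σ[ w′ ∈ Star R x q ] Unique (x ∷ targets w′)
    suffixFrom w       (here refl) unique       = w , unique
    suffixFrom (r ◅ w) (there x∈)  (_ ∷ unique) = suffixFrom w x∈ unique

    shortcut : ∀ {p q} → Star R p q → Σ[ w ∈ Star R p q ] Unique (p ∷ targets w)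
    shortcut ε = ε , [] ∷ []
    shortcut {p} (_◅_ {j = y} r w) with shortcut w
    ... | w′ , unique with p ∈? y ∷ targets w′
    ...   | yes p∈ = suffixFrom w′ p∈ unique
    ...   | no p∉  = r ◅ w′ , ¬Any⇒All¬ _ p∉ ∷ unique

Avoiding : ∀ {a ℓ} {I : Set a} → I → Rel I ℓ → Rel I _
Avoiding a R x y = R x y × x ≢ a × y ≢ a

targets-avoid : ∀ {a ℓ} {I : Set a} {R : Rel I ℓ} {c p q} (w : Star (Avoiding c R) p q) →
                All (c ≢_) (targets w)
targets-avoid ε                   = []
targets-avoid ((_ , _ , y≢c) ◅ w) = ≢-sym y≢c ∷ targets-avoid w

module _ {n : ℕ} {A : Digraph n} where

  separatedByTree : ¬ UCycle A → ∀ {a p q} → Adj A a p → Adj A a q → p ≢ q →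
                    Star (Avoiding a (Adj A)) p q → ⊥
  separatedByTree noCycle {a} {p} {q} ap aq p≢q walk with shortcut _≟_ walk
  ... | ε , _ = p≢q refl
  ... | w@(_◅_ {j = y} (_ , p≢a , _) w′) , unique =
    noCycle (length (targets w′) , lookup cycle , lookup-injective cycle-unique , steps , closing)
    where
    cycle : List (Fin n)
    cycle = a ∷ p ∷ y ∷ targets w′

    cycle-unique : Unique cycle
    cycle-unique = (≢-sym p≢a ∷ targets-avoid w) ∷ unique

    steps : ∀ i → Adj A (lookup cycle (inject₁ i)) (lookup cycle (suc i))
    steps zero    = ap
    steps (suc i) = proj₁ (lookup-targets-step w i)

    closing : Adj A (lookup cycle (fromℕ (suc (suc (length (targets w′)))))) a
    closing = subst (λ t → Adj A t a) (sym (lookup-targets-last w)) (swap aq)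

  Reach⇒through⊎avoiding : ∀ {u v x} → Reach A v x →
                           Reach A v u ⊎ (v ≢ u × Star (Avoiding u (Arc A)) v x)
  Reach⇒through⊎avoiding {u} {v} vx with v ≟ u
  Reach⇒through⊎avoiding _        | yes refl = inj₁ ε
  Reach⇒through⊎avoiding ε        | no v≢u   = inj₂ (v≢u , ε)
  Reach⇒through⊎avoiding (r ◅ rs) | no v≢u with Reach⇒through⊎avoiding rs
  ... | inj₁ yu         = inj₁ (r ◅ yu)
  ... | inj₂ (y≢u , yx) = inj₂ (v≢u , (r , v≢u , y≢u) ◅ yx)

  avoidingParent⇒refl : ∀ {u v c} → indeg A c ≡ 1 → Arc A u c → Star (Avoiding u (Arc A)) v c → v ≡ c
  avoidingParent⇒refl deg≡1 uc ε = refl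
  avoidingParent⇒refl deg≡1 uc ((vy , v≢u , _) ◅ yc) with avoidingParent⇒refl deg≡1 uc yc
  ... | refl = contradiction (indeg≡1⇒uniqueParent A deg≡1 vy uc) v≢u

  Arc◅Reach⇒⁺ : ∀ {x y z} → Arc A x y → Reach A y z → TransClosure (Arc A) x z
  Arc◅Reach⇒⁺ xy ε         = [ xy ]
  Arc◅Reach⇒⁺ xy (yw ◅ wz) = xy ∷ Arc◅Reach⇒⁺ yw wz

  module _ (acyclic : Acyclic A) where

    belowChild≢ : ∀ {a c x} → Arc A a c → Reach A c x → x ≢ a
    belowChild≢ ac cx refl = acyclic _ (Arc◅Reach⇒⁺ ac cx)

    Reach-unique : ∀ {p q} (w : Reach A p q) → Unique (p ∷ targets w)
    Reach-unique ε       = [] ∷ []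
    Reach-unique (r ◅ w) =
      ¬Any⇒All¬ _ (λ p∈ → belowChild≢ r (∈-vertices⇒Star w p∈) refl) ∷ Reach-unique w

    Reach-avoiding : ∀ {a p x} → (∀ {t} → Reach A p t → t ≢ a) →
                     Reach A p x → Star (Avoiding a (Arc A)) p x
    Reach-avoiding below≢ ε        = ε
    Reach-avoiding below≢ (r ◅ rs) =
      (r , below≢ ε , below≢ (r ◅ ε)) ◅ Reach-avoiding (below≢ ∘ (r ◅_)) rs

    childrenSeparated : ¬ UCycle A → ∀ {a c c′ x y w} → Arc A a c → Arc A a c′ → c ≢ c′ →
                        Reach A c x → Reach A c′ y →
                        Star (Avoiding a (Arc A)) w x → Star (Avoiding a (Arc A)) w y → ⊥
    childrenSeparated noCycle ac ac′ c≢c′ cx c′y wx wy =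
      separatedByTree noCycle (inj₁ ac) (inj₁ ac′) c≢c′
        (undirected (Reach-avoiding (belowChild≢ ac) cx) ◅◅ reverse flipped (undirected wx) ◅◅
         undirected wy ◅◅ reverse flipped (undirected (Reach-avoiding (belowChild≢ ac′) c′y)))
      where
      undirected : ∀ {a p q} → Star (Avoiding a (Arc A)) p q → Star (Avoiding a (Adj A)) p q
      undirected = Star.map λ (pq , p≢a , q≢a) → inj₁ pq , p≢a , q≢a
      flipped : ∀ {a p q} → Avoiding a (Adj A) p q → Avoiding a (Adj A) q p
      flipped (pq , p≢a , q≢a) = swap pq , q≢a , p≢a

    module _ (sinksAreLeaves : ∀ v → outdeg A v ≡ 0 → indeg A v ≡ 1) where

      leafOrWalk : ∀ k p → (∃[ x ] InC A p x) ⊎ (∃[ q ] Σ[ w ∈ Reach A p q ] length (targets w) ≡ k)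
      leafOrWalk zero    p = inj₂ (p , ε , refl)
      leafOrWalk (suc k) p with outdeg A p ℕ.≟ 0
      ... | yes deg≡0 = inj₁ (p , (sinksAreLeaves p deg≡0 , deg≡0) , ε)
      ... | no deg≢0 with Internal⇒child A (n≢0⇒n>0 deg≢0)
      ...   | c , pc with leafOrWalk k c
      ...     | inj₁ (x , xLeaf , cx)  = inj₁ (x , xLeaf , pc ◅ cx)
      ...     | inj₂ (q , w , length≡k) = inj₂ (q , pc ◅ w , cong suc length≡k)

      -- Walks in an acyclic digraph are paths, so have fewer than n arcs.
      reachesLeaf : ∀ p → ∃[ x ] InC A p x
      reachesLeaf p with leafOrWalk n p
      ... | inj₁ leaf               = leaf
      ... | inj₂ (_ , w , length≡n) = ⊥-elim (<-irrefl length≡n (Unique⇒length≤ (Reach-unique w)))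

module _ {n : ℕ} {A : Digraph n} (acyclic : Acyclic A) (noCycle : ¬ UCycle A)
         (sinksAreLeaves : ∀ v → outdeg A v ≡ 0 → indeg A v ≡ 1)
         (unaryOverLeaf : ∀ v c → outdeg A v ≡ 1 → Arc A v c → Leaf A c) where

  Leaf⊎sibling : ∀ {a c} → Arc A a c → Leaf A c ⊎ ∃[ c′ ] c′ ≢ c × Arc A a c′
  Leaf⊎sibling {a} {c} ac with outdeg A a ℕ.≟ 1
  ... | yes deg≡1 = inj₁ (unaryOverLeaf a c deg≡1 ac)
  ... | no deg≢1  = inj₂ (outdeg≢1⇒otherChild A deg≢1 ac)

  properAncestor⇒C⊈ : ∀ {a b} → Internal A b → a ≢ b → Reach A a b →
                      ¬ (∀ x → InC A a x → InC A b x)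
  properAncestor⇒C⊈ ib a≢b ε = ⊥-elim (a≢b refl)
  properAncestor⇒C⊈ {b = b} ib _ (ad ◅ db) C⊆ with Leaf⊎sibling ad
  ... | inj₁ dLeaf =
    Leaf⇒¬Internal A (subst (Leaf A) (outdeg≡0⇒Reach-refl A (proj₂ dLeaf) db) dLeaf) ib
  ... | inj₂ (d′ , d′≢d , ad′) with reachesLeaf acyclic sinksAreLeaves d′
  ...   | z , zLeaf , d′z =
    childrenSeparated acyclic noCycle ad′ ad d′≢d d′z db
      (Reach-avoiding acyclic (belowChild≢ acyclic ad ∘ (db ◅◅_)) bz) ε
    where
    bz : Reach A b z
    bz = proj₂ (C⊆ z (zLeaf , ad′ ◅ d′z))

  SameC⇒avoidingPath : ∀ {u v x} → Internal A u → u ≢ v → SameC A u v →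
                       InC A u x → Star (Avoiding u (Arc A)) v x
  SameC⇒avoidingPath iu u≢v same x∈Cu with Reach⇒through⊎avoiding (proj₂ (proj₁ (same _) x∈Cu))
  ... | inj₁ vu       = ⊥-elim (properAncestor⇒C⊈ iu (≢-sym u≢v) vu (proj₂ ∘ same))
  ... | inj₂ (_ , vx) = vx

  internal-distinctC : ∀ u v → Internal A u → Internal A v → u ≢ v → ¬ SameC A u v
  internal-distinctC u v iu iv u≢v same = childless (proj₂ (Internal⇒child A iu))
    where
    avoidingPath : ∀ {x} → InC A u x → Star (Avoiding u (Arc A)) v x
    avoidingPath = SameC⇒avoidingPath iu u≢v same

    childless : ∀ {c} → ¬ Arc A u c
    childless uc with Leaf⊎sibling uc
    ... | inj₁ cLeaf =
      let v≡c = avoidingParent⇒refl (proj₁ cLeaf) uc (avoidingPath (cLeaf , uc ◅ ε))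
      in Leaf⇒¬Internal A (subst (Leaf A) (sym v≡c) cLeaf) iv
    ... | inj₂ (c′ , c′≢c , uc′)
        with reachesLeaf acyclic sinksAreLeaves _ | reachesLeaf acyclic sinksAreLeaves c′
    ...   | x , xLeaf , cx | y , yLeaf , c′y =
      childrenSeparated acyclic noCycle uc′ uc c′≢c c′y cx
        (avoidingPath (yLeaf , uc′ ◅ c′y)) (avoidingPath (xLeaf , uc ◅ cx))

lemma9p3 : {n : ℕ} (A : Digraph n) → IsNetwork A → Arboreal A
           → (∀ v c → outdeg A v ≡ 1 → Arc A v c → Leaf A c)
           → ∀ u v → Internal A u → Internal A v → u ≢ v → ¬ SameC A u v
lemma9p3 A (_ , acyclic , _ , _ , _ , sinksAreLeaves , _) (_ , noCycle) unaryOverLeaf =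
  internal-distinctC acyclic noCycle sinksAreLeaves unaryOverLeaf
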